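{- Let $G\in\mathcal{G}$, with cliques on $X=\{x_1,\ldots,x_m\}$ and $Y=\{y_1,\ldots,y_n\}$, where $m=n>1$, and suppose $\{x_1,y_1\}$ is the only edge of $G$ with one endpoint in $X$ and the other in $Y$. Then $T_2(G)$ is not well-covered.
   Context: $\mathcal{G}$ is the class of graphs obtained by taking the disjoint union of a complete graph $K_m$ with vertex set $X=\{x_1,\ldots,x_m\}$ and a complete graph $K_n$ with vertex set $Y=\{y_1,\ldots,y_n\}$, where $n\geq m$, and then adding some (possibly no) edges each joining a vertex of $X$ to a vertex of $Y$. The $2$-token graph $T_2(G)$ has as vertices the $2$-subsets of $V(G)$, two of them adjacent if their symmetric difference is an edge of $G$. A graph is well-covered if all of its maximal (with respect to inclusion) independent sets have the same cardinality. -}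

module Defs where

open import Level using (Level; _⊔_) renaming (suc to lsuc)
open import Data.Nat using (ℕ; _+_)
open import Data.Fin using (Fin; toℕ; splitAt; _<_)
open import Data.Sum using (_⊎_; inj₁; inj₂)
open import Data.Product using (Σ; _×_; _,_; ∃-syntax)
open import Data.Empty using (⊥)
open import Data.Unit using (⊤)
open import Data.List using (List; length)
open import Data.List.Membership.Propositional using (_∈_; _∉_)
open import Data.List.Relation.Unary.Unique.Propositional using (Unique)
open import Relation.Nullary using (¬_)
open import Relation.Binary.PropositionalEquality using (_≡_; _≢_)

record Graph (V : Set) : Set₁ where
  field
    Adj : V → V → Set

open Graph public

-- Independent sets, maximality, well-coveredness.
-- A finite vertex set is represented by a duplicate-free list; its
-- cardinality is the length of the list.

Independent : {V : Set} → Graph V → List V → Set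
Independent G S = ∀ {u v} → u ∈ S → v ∈ S → ¬ Adj G u v

MaximalIndependent : {V : Set} → Graph V → List V → Set
MaximalIndependent G S =
  Unique S × Independent G S ×
  (∀ w → w ∉ S → ¬ (∀ {v} → v ∈ S → ¬ Adj G w v × ¬ Adj G v w))

WellCovered : {V : Set} → Graph V → Set
WellCovered G = ∀ S T → MaximalIndependent G S → MaximalIndependent G T →
                length S ≡ length T

TwoSubset : ℕ → Set
TwoSubset N = Σ (Fin N × Fin N) (λ p → Data.Product.proj₁ p < Data.Product.proj₂ p)

_∈₂_ : {N : ℕ} → Fin N → TwoSubset N → Set
x ∈₂ ((a , b) , _) = (x ≡ a) ⊎ (x ≡ b)

InSymDiff : {N : ℕ} → Fin N → TwoSubset N → TwoSubset N → Set
InSymDiff x A B = (x ∈₂ A × ¬ x ∈₂ B) ⊎ (x ∈₂ B × ¬ x ∈₂ A)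

T₂ : {N : ℕ} → Graph (Fin N) → Graph (TwoSubset N)
Adj (T₂ G) A B = ∃[ u ] ∃[ v ] (Adj G u v ×
                   (∀ x → (InSymDiff x A B → (x ≡ u ⊎ x ≡ v)) ×
                          ((x ≡ u ⊎ x ≡ v) → InSymDiff x A B)))

-- Graphs of the class 𝒢: vertex set Fin (m + n); the first m vertices
-- (via splitAt) form X = {x₁,…,x_m} (x_{i+1} ↦ inj₁ i), the last n form
-- Y = {y₁,…,y_n} (y_{j+1} ↦ inj₂ j).

AdjXY : (m n : ℕ) → (Fin m → Fin n → Set) → (Fin m ⊎ Fin n) → (Fin m ⊎ Fin n) → Set
AdjXY m n C (inj₁ i) (inj₁ j) = i ≢ j
AdjXY m n C (inj₂ i) (inj₂ j) = i ≢ j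
AdjXY m n C (inj₁ i) (inj₂ j) = C i j
AdjXY m n C (inj₂ j) (inj₁ i) = C i j

𝒢-graph : (m n : ℕ) → (Fin m → Fin n → Set) → Graph (Fin (m + n))
Adj (𝒢-graph m n C) u v = AdjXY m n C (splitAt m u) (splitAt m v)

OnlyX₁Y₁ : (m n : ℕ) → Fin m → Fin n → Set
OnlyX₁Y₁ m n i j = (toℕ i ≡ 0) × (toℕ j ≡ 0)

-- Two 2-subsets of V(G) are adjacent in T₂(G) exactly when they share a vertex and their
-- other vertices are adjacent in G.  Reading a set S of 2-subsets as a graph H on V(G), S is
-- independent when any two H-edges at a common vertex have non-adjacent other ends, and it
-- cannot be extended when every 2-subset {c , d} outside S meets an H-edge {c , e} with
-- d ~ e.  Write n = k + 2t with k ∈ {2, 3} and pair the last 2t indices as j, j′; on them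
-- take the 4-cycles x_j y_j y_j′ x_j′.  Each of these vertices then has one H-neighbour in X
-- and one in Y, which, X and Y being cliques, dominates every 2-subset through it, and the
-- cross edge x₁ y₁ never interferes.  Completing this ladder by two maximal configurations
-- of different sizes on the first k indices (4 and 2 pairs for k = 2, 4 and 5 for k = 3,
-- checked by evaluation) gives maximal independent sets of different cardinalities.

module Submission where

open import Defs
open import Data.Nat using (ℕ; _<_)
open import Relation.Nullary using (¬_)

open import Function using (_∘_; id)
open import Data.Nat as ℕ using (zero; suc; _+_; s≤s; z≤n)
open import Data.Nat.Properties using (<⇒≱; m≤m+n; +-cancelʳ-≡)
open import Data.Fin as Fin using (Fin; zero; suc; toℕ; splitAt; join; _↑ˡ_; _↑ʳ_; #_)
open import Data.Fin.Properties
  using (_≟_; suc-injective; <-cmp; <-asym; <-irrelevant; <⇒≢; ↑ʳ-injective; toℕ-↑ʳ;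
         splitAt-join; join-splitAt; splitAt⁻¹-↑ˡ; splitAt⁻¹-↑ʳ)
open import Data.Sum as Sum using (_⊎_; inj₁; inj₂; reduce)
open import Data.Sum.Properties using (inj₁-injective; inj₂-injective)
import Data.Sum.Properties as Sum
open import Data.Product using (∃; _×_; _,_; proj₁; proj₂)
import Data.Product.Properties as Product
open import Data.Empty using (⊥; ⊥-elim)
open import Data.List using (List; []; _∷_; _++_; map; length; allFin; deduplicate)
open import Data.List.Properties using (length-++; length-map; map-++)
open import Data.List.Relation.Unary.Any using (Any; here; there; any?)
import Data.List.Relation.Unary.Any as Any
import Data.List.Relation.Unary.Any.Properties as Any
open import Data.List.Relation.Unary.All using (All; all?)
import Data.List.Relation.Unary.All as All
open import Data.List.Relation.Unary.AllPairs using (AllPairs; allPairs?)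
import Data.List.Relation.Unary.AllPairs as AllPairs
import Data.List.Relation.Unary.AllPairs.Properties as AllPairs
open import Data.List.Relation.Unary.Unique.Propositional using (Unique)
import Data.List.Relation.Unary.Unique.Propositional.Properties as Unique
open import Data.List.Relation.Unary.Unique.DecPropositional.Properties using (deduplicate-!)
open import Data.List.Relation.Binary.Subset.Propositional using (_⊆_)
open import Data.List.Membership.Propositional using (_∈_; _∉_; find; lose)
open import Data.List.Membership.Propositional.Properties
  using (∈-map⁺; ∈-map⁻; ∈-++⁺ˡ; ∈-++⁺ʳ; ∈-++⁻; ∈-allFin; ∈-deduplicate⁻; ∈-deduplicate⁺)
open import Relation.Nullary using (Dec; yes; no; ¬?)
open import Relation.Nullary.Decidable using (_×-dec_; _⊎-dec_; map′; from-yes; False; toWitnessFalse)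
open import Relation.Binary.Definitions using (Decidable; DecidableEquality; tri<; tri≈; tri>)
open import Relation.Binary.PropositionalEquality
open ≡-Reasoning

module _ {N : ℕ} where

  record IsPair (A : TwoSubset N) (a b : Fin N) : Set where
    field
      elements : ∀ {x} → x ∈₂ A → x ≡ a ⊎ x ≡ b
      contains : ∀ {x} → x ≡ a ⊎ x ≡ b → x ∈₂ A

  open IsPair public

  isPair-self : ∀ {a b} (a<b : a Fin.< b) → IsPair ((a , b) , a<b) a b
  isPair-self a<b = record { elements = id ; contains = id }

  isPair-swap : ∀ {A a b} → IsPair A a b → IsPair A b a
  isPair-swap p = record { elements = Sum.swap ∘ elements p ; contains = contains p ∘ Sum.swap }

  isPair-≢ : ∀ {A a b} → IsPair A a b → a ≢ b
  isPair-≢ {((u , v) , u<v)} p refl =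
    <⇒≢ u<v (trans (reduce (elements p (inj₁ refl))) (sym (reduce (elements p (inj₂ refl)))))

  isPair-unique : ∀ {A B a b} → IsPair A a b → IsPair B a b → A ≡ B
  isPair-unique {(_ , a₁<a₂)} {(_ , b₁<b₂)} pA pB
    with contains pB (elements pA (inj₁ refl)) | contains pB (elements pA (inj₂ refl))
  ... | inj₁ refl | inj₁ refl = ⊥-elim (<⇒≢ a₁<a₂ refl)
  ... | inj₁ refl | inj₂ refl = cong (_ ,_) (<-irrelevant a₁<a₂ b₁<b₂)
  ... | inj₂ refl | inj₁ refl = ⊥-elim (<-asym a₁<a₂ b₁<b₂)
  ... | inj₂ refl | inj₂ refl = ⊥-elim (<⇒≢ a₁<a₂ refl)

  ⟅_,_⟆ : (a b : Fin N) → a ≢ b → TwoSubset N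
  ⟅ a , b ⟆ a≢b with <-cmp a b
  ... | tri< a<b _ _ = (a , b) , a<b
  ... | tri≈ _ a≡b _ = ⊥-elim (a≢b a≡b)
  ... | tri> _ _ b<a = (b , a) , b<a

  ⟅⟆-isPair : ∀ a b (a≢b : a ≢ b) → IsPair (⟅ a , b ⟆ a≢b) a b
  ⟅⟆-isPair a b a≢b with <-cmp a b
  ... | tri< a<b _ _ = isPair-self a<b
  ... | tri≈ _ a≡b _ = ⊥-elim (a≢b a≡b)
  ... | tri> _ _ b<a = isPair-swap (isPair-self b<a)

  _≟ₜ_ : DecidableEquality (TwoSubset N)
  _≟ₜ_ = Product.≡-dec (Product.≡-dec _≟_ _≟_) (λ p q → yes (<-irrelevant p q))

private
  no-three-in-two : ∀ {A : Set} {x y z u v : A} → x ≢ y → x ≢ z → y ≢ z →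
                    x ≡ u ⊎ x ≡ v → y ≡ u ⊎ y ≡ v → z ≡ u ⊎ z ≡ v → ⊥
  no-three-in-two x≢y x≢z y≢z (inj₁ refl) (inj₁ refl) _ = x≢y refl
  no-three-in-two x≢y x≢z y≢z (inj₂ refl) (inj₂ refl) _ = x≢y refl
  no-three-in-two x≢y x≢z y≢z (inj₁ refl) (inj₂ refl) (inj₁ refl) = x≢z refl
  no-three-in-two x≢y x≢z y≢z (inj₁ refl) (inj₂ refl) (inj₂ refl) = y≢z refl
  no-three-in-two x≢y x≢z y≢z (inj₂ refl) (inj₁ refl) (inj₁ refl) = y≢z refl
  no-three-in-two x≢y x≢z y≢z (inj₂ refl) (inj₁ refl) (inj₂ refl) = x≢z refl

symDiff-sharing : ∀ {N} {A B : TwoSubset N} {s p q x} → IsPair A s p → IsPair B s q →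
                  InSymDiff x A B → x ≡ p ⊎ x ≡ q
symDiff-sharing pA pB (inj₁ (x∈A , x∉B)) =
  Sum.[ (λ x≡s → ⊥-elim (x∉B (contains pB (inj₁ x≡s)))) , inj₁ ] (elements pA x∈A)
symDiff-sharing pA pB (inj₂ (x∈B , x∉A)) =
  Sum.[ (λ x≡s → ⊥-elim (x∉A (contains pA (inj₁ x≡s)))) , inj₂ ] (elements pB x∈B)

module _ {N : ℕ} (G : Graph (Fin N)) where

  adjacent-sharing : ∀ {A B s p q} → IsPair A s p → IsPair B s q →
                     p ≢ q → Adj G p q → Adj (T₂ G) A B
  adjacent-sharing {A} {B} {s} {p} {q} pA pB p≢q p~q =
    p , q , p~q , λ x → symDiff-sharing pA pB , inSymDiff
    where
    inSymDiff : ∀ {x} → x ≡ p ⊎ x ≡ q → InSymDiff x A B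
    inSymDiff (inj₁ refl) = inj₁ (contains pA (inj₂ refl) ,
      Sum.[ isPair-≢ pA ∘ sym , p≢q ] ∘ elements pB)
    inSymDiff (inj₂ refl) = inj₂ (contains pB (inj₂ refl) ,
      Sum.[ isPair-≢ pB ∘ sym , p≢q ∘ sym ] ∘ elements pA)

  nonadjacent-sharing : (∀ u → ¬ Adj G u u) → ∀ {A B s p q} →
                        IsPair A s p → IsPair B s q →
                        ¬ Adj G p q → ¬ Adj G q p → ¬ Adj (T₂ G) A B
  nonadjacent-sharing irrefl {p = p} {q} pA pB p≁q q≁p (u , v , u~v , symDiff) =
    ends (symDiff-sharing pA pB (proj₂ (symDiff u) (inj₁ refl)))
         (symDiff-sharing pA pB (proj₂ (symDiff v) (inj₂ refl)))
    where
    ends : u ≡ p ⊎ u ≡ q → v ≡ p ⊎ v ≡ q → ⊥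
    ends (inj₁ refl) (inj₁ refl) = irrefl u u~v
    ends (inj₁ refl) (inj₂ refl) = p≁q u~v
    ends (inj₂ refl) (inj₁ refl) = q≁p u~v
    ends (inj₂ refl) (inj₂ refl) = irrefl u u~v

  -- The symmetric difference of disjoint 2-subsets has four elements, too many for an edge.
  nonadjacent-disjoint : ∀ {A B a₁ a₂ b₁ b₂} → IsPair A a₁ a₂ → IsPair B b₁ b₂ →
                         a₁ ≢ b₁ → a₁ ≢ b₂ → a₂ ≢ b₁ → a₂ ≢ b₂ → ¬ Adj (T₂ G) A B
  nonadjacent-disjoint {A} {B} pA pB a₁≢b₁ a₁≢b₂ a₂≢b₁ a₂≢b₂ (u , v , _ , symDiff) =
    no-three-in-two (isPair-≢ pA) a₁≢b₁ a₂≢b₁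
      (edgeEnd (inj₁ (contains pA (inj₁ refl) , Sum.[ a₁≢b₁ , a₁≢b₂ ] ∘ elements pB)))
      (edgeEnd (inj₁ (contains pA (inj₂ refl) , Sum.[ a₂≢b₁ , a₂≢b₂ ] ∘ elements pB)))
      (edgeEnd (inj₂ (contains pB (inj₁ refl) ,
                      Sum.[ a₁≢b₁ ∘ sym , a₂≢b₁ ∘ sym ] ∘ elements pA)))
    where
    edgeEnd : ∀ {x} → InSymDiff x A B → x ≡ u ⊎ x ≡ v
    edgeEnd {x} = proj₁ (symDiff x)

module VertexPairs {m n : ℕ} {C : Fin m → Fin n → Set} (C? : Decidable C) where

  Vertex : Set
  Vertex = Fin m ⊎ Fin n

  G : Graph (Fin (m + n))
  G = 𝒢-graph m n C

  infix 4 _~_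
  _~_ : Vertex → Vertex → Set
  _~_ = AdjXY m n C

  ~-sym : ∀ u v → u ~ v → v ~ u
  ~-sym (inj₁ i) (inj₁ j) i≢j = i≢j ∘ sym
  ~-sym (inj₁ i) (inj₂ j) Cij = Cij
  ~-sym (inj₂ j) (inj₁ i) Cij = Cij
  ~-sym (inj₂ i) (inj₂ j) i≢j = i≢j ∘ sym

  ~-irrefl : ∀ u → ¬ u ~ u
  ~-irrefl (inj₁ i) i≢i = i≢i refl
  ~-irrefl (inj₂ i) i≢i = i≢i refl

  _~?_ : ∀ u v → Dec (u ~ v)
  inj₁ i ~? inj₁ j = ¬? (i ≟ j)
  inj₁ i ~? inj₂ j = C? i j
  inj₂ j ~? inj₁ i = C? i j
  inj₂ i ~? inj₂ j = ¬? (i ≟ j)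

  _≟ᵥ_ : DecidableEquality Vertex
  _≟ᵥ_ = Sum.≡-dec _≟_ _≟_

  ≡⊎~ˣ : ∀ i j → inj₁ {B = Fin n} j ≡ inj₁ i ⊎ inj₁ i ~ inj₁ j
  ≡⊎~ˣ i j with i ≟ j
  ... | yes refl = inj₁ refl
  ... | no i≢j = inj₂ i≢j

  ≡⊎~ʸ : ∀ i j → inj₂ {A = Fin m} j ≡ inj₂ i ⊎ inj₂ i ~ inj₂ j
  ≡⊎~ʸ i j with i ≟ j
  ... | yes refl = inj₁ refl
  ... | no i≢j = inj₂ i≢j

  embed : Vertex → Fin (m + n)
  embed = join m n

  embed-injective : ∀ {u v} → embed u ≡ embed v → u ≡ v
  embed-injective {u} {v} e =
    trans (sym (splitAt-join m n u)) (trans (cong (splitAt m) e) (splitAt-join m n v))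

  ~⇒Adj : ∀ u v → u ~ v → Adj G (embed u) (embed v)
  ~⇒Adj u v = subst₂ _~_ (sym (splitAt-join m n u)) (sym (splitAt-join m n v))

  Adj⇒~ : ∀ u v → Adj G (embed u) (embed v) → u ~ v
  Adj⇒~ u v = subst₂ _~_ (splitAt-join m n u) (splitAt-join m n v)

  G-irrefl : ∀ a → ¬ Adj G a a
  G-irrefl a = ~-irrefl (splitAt m a)

  splitAt-isPair : (A : TwoSubset (m + n)) →
                   IsPair A (embed (splitAt m (proj₁ (proj₁ A)))) (embed (splitAt m (proj₂ (proj₁ A))))
  splitAt-isPair ((a , b) , a<b) =
    subst₂ (IsPair _) (sym (join-splitAt m n a)) (sym (join-splitAt m n b)) (isPair-self a<b)

  record VPair : Set where
    constructor vpair
    field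
      end₁ end₂ : Vertex
      distinct : end₁ ≢ end₂

  open VPair public

  infix 6 _─_
  _─_ : (u v : Vertex) {u≢v : False (u ≟ᵥ v)} → VPair
  (u ─ v) {u≢v} = vpair u v (toWitnessFalse u≢v)

  reverse : VPair → VPair
  reverse (vpair u v u≢v) = vpair v u (u≢v ∘ sym)

  orientations : VPair → List VPair
  orientations P = P ∷ reverse P ∷ []

  ⟦_⟧ : VPair → TwoSubset (m + n)
  ⟦ vpair u v u≢v ⟧ = ⟅ embed u , embed v ⟆ (u≢v ∘ embed-injective)

  ⟦⟧-isPair : ∀ P → IsPair ⟦ P ⟧ (embed (end₁ P)) (embed (end₂ P))
  ⟦⟧-isPair (vpair u v u≢v) = ⟅⟆-isPair (embed u) (embed v) (u≢v ∘ embed-injective)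

  ⟦⟧-orientation : ∀ {P P′} → P′ ∈ orientations P → ⟦ P′ ⟧ ≡ ⟦ P ⟧
  ⟦⟧-orientation (here refl) = refl
  ⟦⟧-orientation {P} (there (here refl)) =
    isPair-unique (⟦⟧-isPair (reverse P)) (isPair-swap (⟦⟧-isPair P))

  SameEnds : VPair → VPair → Set
  SameEnds P Q = Any (λ P′ → end₁ P′ ≡ end₁ Q × end₂ P′ ≡ end₂ Q) (orientations P)

  ⟦⟧-injective : ∀ {P Q} → ⟦ P ⟧ ≡ ⟦ Q ⟧ → SameEnds P Q
  ⟦⟧-injective {P} {Q} ⟦P⟧≡⟦Q⟧ with endOfQ (inj₁ refl) | endOfQ (inj₂ refl)
    where
    endOfQ : ∀ {x} → x ≡ embed (end₁ P) ⊎ x ≡ embed (end₂ P) →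
             x ≡ embed (end₁ Q) ⊎ x ≡ embed (end₂ Q)
    endOfQ = elements (⟦⟧-isPair Q) ∘ subst (_ ∈₂_) ⟦P⟧≡⟦Q⟧ ∘ contains (⟦⟧-isPair P)
  ... | inj₁ e₁ | inj₁ e₂ = ⊥-elim (distinct P (embed-injective (trans e₁ (sym e₂))))
  ... | inj₁ e₁ | inj₂ e₂ = here (embed-injective e₁ , embed-injective e₂)
  ... | inj₂ e₁ | inj₁ e₂ = there (here (embed-injective e₂ , embed-injective e₁))
  ... | inj₂ e₁ | inj₂ e₂ = ⊥-elim (distinct P (embed-injective (trans e₁ (sym e₂))))

  Hinged : VPair → VPair → Set
  Hinged P Q = end₁ P ≡ end₁ Q × ¬ end₂ P ~ end₂ Q

  Disjoint : VPair → VPair → Set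
  Disjoint P Q = end₁ P ≢ end₁ Q × end₁ P ≢ end₂ Q × end₂ P ≢ end₁ Q × end₂ P ≢ end₂ Q

  Compatible : VPair → VPair → Set
  Compatible P Q = Disjoint P Q ⊎ Any (λ P′ → Any (Hinged P′) (orientations Q)) (orientations P)

  hinge : ∀ {P Q P′ Q′} → P′ ∈ orientations P → Q′ ∈ orientations Q → Hinged P′ Q′ → Compatible P Q
  hinge P′∈ Q′∈ h = inj₂ (lose P′∈ (lose Q′∈ h))

  hinged⇒nonadjacent : ∀ P Q → Hinged P Q → ¬ Adj (T₂ G) ⟦ P ⟧ ⟦ Q ⟧
  hinged⇒nonadjacent P@(vpair u v _) Q@(vpair .u w _) (refl , v≁w) =
    nonadjacent-sharing G G-irrefl (⟦⟧-isPair P) (⟦⟧-isPair Q)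
      (v≁w ∘ Adj⇒~ v w) (v≁w ∘ ~-sym w v ∘ Adj⇒~ w v)

  compatible⇒nonadjacent : ∀ {P Q} → Compatible P Q → ¬ Adj (T₂ G) ⟦ P ⟧ ⟦ Q ⟧
  compatible⇒nonadjacent {P} {Q} (inj₁ (≢₁₁ , ≢₁₂ , ≢₂₁ , ≢₂₂)) =
    nonadjacent-disjoint G (⟦⟧-isPair P) (⟦⟧-isPair Q)
      (≢₁₁ ∘ embed-injective) (≢₁₂ ∘ embed-injective) (≢₂₁ ∘ embed-injective) (≢₂₂ ∘ embed-injective)
  compatible⇒nonadjacent (inj₂ hinges) =
    let P′ , P′∈ , hinges′ = find hinges
        Q′ , Q′∈ , hinged = find hinges′
    in subst₂ (λ A B → ¬ Adj (T₂ G) A B) (⟦⟧-orientation P′∈) (⟦⟧-orientation Q′∈)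
              (hinged⇒nonadjacent P′ Q′ hinged)

  compatible-sym : ∀ {P Q} → Compatible P Q → Compatible Q P
  compatible-sym (inj₁ (≢₁₁ , ≢₁₂ , ≢₂₁ , ≢₂₂)) = inj₁ (≢₁₁ ∘ sym , ≢₂₁ ∘ sym , ≢₁₂ ∘ sym , ≢₂₂ ∘ sym)
  compatible-sym (inj₂ hinges) =
    inj₂ (Any.map (Any.map (λ {Q′} (e , ≁) → sym e , ≁ ∘ ~-sym _ (end₂ Q′))) (Any.swap hinges))

  disjoint⇒¬sameEnds : ∀ {P Q} → Disjoint P Q → ¬ SameEnds P Q
  disjoint⇒¬sameEnds (≢₁₁ , _) (here (e , _)) = ≢₁₁ e
  disjoint⇒¬sameEnds (_ , _ , ≢₂₁ , _) (there (here (e , _))) = ≢₂₁ e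

  -- {c , d} is Q, or is adjacent to Q in T₂(G) through the common vertex c.
  Blocks : VPair → Vertex → Vertex → Set
  Blocks Q c d = end₁ Q ≡ c × (end₂ Q ≡ d ⊎ d ~ end₂ Q)

  Covers : VPair → Vertex → Vertex → Set
  Covers Q c d = Any (λ Q′ → Blocks Q′ c d ⊎ Blocks Q′ d c) (orientations Q)

  blocks-sound : ∀ {A} c d Q → IsPair A (embed c) (embed d) → Blocks Q c d →
                 A ≡ ⟦ Q ⟧ ⊎ Adj (T₂ G) A ⟦ Q ⟧
  blocks-sound _ _ Q pA (refl , inj₁ refl) = inj₁ (isPair-unique pA (⟦⟧-isPair Q))
  blocks-sound _ d Q pA (refl , inj₂ d~w) =
    inj₂ (adjacent-sharing G pA (⟦⟧-isPair Q) d≢w (~⇒Adj d (end₂ Q) d~w))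
    where
    d≢w : embed d ≢ embed (end₂ Q)
    d≢w e = ~-irrefl d (subst (d ~_) (sym (embed-injective e)) d~w)

  covers-sound : ∀ {A Q} c d → IsPair A (embed c) (embed d) → Covers Q c d →
                 A ≡ ⟦ Q ⟧ ⊎ Adj (T₂ G) A ⟦ Q ⟧
  covers-sound {A} c d pA covers =
    let Q′ , Q′∈ , blocks = find covers
    in subst (λ B → A ≡ B ⊎ Adj (T₂ G) A B) (⟦⟧-orientation Q′∈)
             (Sum.[ blocks-sound c d Q′ pA , blocks-sound d c Q′ (isPair-swap pA) ]′ blocks)

  sameEnds? : ∀ P Q → Dec (SameEnds P Q)
  sameEnds? P Q = any? (λ P′ → (end₁ P′ ≟ᵥ end₁ Q) ×-dec (end₂ P′ ≟ᵥ end₂ Q)) (orientations P)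

  compatible? : ∀ P Q → Dec (Compatible P Q)
  compatible? P Q =
    (¬? (end₁ P ≟ᵥ end₁ Q) ×-dec ¬? (end₁ P ≟ᵥ end₂ Q) ×-dec
     ¬? (end₂ P ≟ᵥ end₁ Q) ×-dec ¬? (end₂ P ≟ᵥ end₂ Q))
    ⊎-dec any? (λ P′ → any? (λ Q′ → (end₁ P′ ≟ᵥ end₁ Q′) ×-dec ¬? (end₂ P′ ~? end₂ Q′))
                            (orientations Q))
               (orientations P)

  covers? : ∀ Q c d → Dec (Covers Q c d)
  covers? Q c d = any? (λ Q′ → blocks? Q′ c d ⊎-dec blocks? Q′ d c) (orientations Q)
    where
    blocks? : ∀ Q c d → Dec (Blocks Q c d)
    blocks? Q c d = (end₁ Q ≟ᵥ c) ×-dec ((end₂ Q ≟ᵥ d) ⊎-dec (d ~? end₂ Q))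

  maximal-independent : (L : List VPair) (S : List (TwoSubset (m + n))) →
                        S ⊆ map ⟦_⟧ L → map ⟦_⟧ L ⊆ S → Unique S →
                        (∀ {P Q} → P ∈ L → Q ∈ L → Compatible P Q) →
                        (∀ c d → c ≢ d → Any (λ Q → Covers Q c d) L) →
                        MaximalIndependent (T₂ G) S
  maximal-independent L S S⊆⟦L⟧ ⟦L⟧⊆S unique compatible covering = unique , independent , maximal
    where
    independent : Independent (T₂ G) S
    independent A∈S B∈S with ∈-map⁻ ⟦_⟧ (S⊆⟦L⟧ A∈S) | ∈-map⁻ ⟦_⟧ (S⊆⟦L⟧ B∈S)
    ... | _ , P∈L , refl | _ , Q∈L , refl = compatible⇒nonadjacent (compatible P∈L Q∈L)

    maximal : ∀ A → A ∉ S → ¬ (∀ {B} → B ∈ S → ¬ Adj (T₂ G) A B × ¬ Adj (T₂ G) B A)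
    maximal A A∉S isolated =
      let c = splitAt m (proj₁ (proj₁ A))
          d = splitAt m (proj₂ (proj₁ A))
          pA = splitAt-isPair A
          Q , Q∈L , covers = find (covering c d (isPair-≢ pA ∘ cong embed))
          ⟦Q⟧∈S = ⟦L⟧⊆S (∈-map⁺ ⟦_⟧ Q∈L)
      in Sum.[ (λ A≡⟦Q⟧ → A∉S (subst (_∈ S) (sym A≡⟦Q⟧) ⟦Q⟧∈S)) , proj₁ (isolated ⟦Q⟧∈S) ]
               (covers-sound c d pA covers)

onlyX₁Y₁? : ∀ m n → Decidable (OnlyX₁Y₁ m n)
onlyX₁Y₁? m n i j = (toℕ i ℕ.≟ 0) ×-dec (toℕ j ℕ.≟ 0)

double : ℕ → ℕ
double zero = zero
double (suc t) = suc (suc (double t))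

mate : ∀ {t} → Fin (double t) → Fin (double t)
mate {suc t} zero = suc zero
mate {suc t} (suc zero) = zero
mate {suc t} (suc (suc j)) = suc (suc (mate j))

mate-involutive : ∀ {t} (j : Fin (double t)) → mate (mate j) ≡ j
mate-involutive {suc t} zero = refl
mate-involutive {suc t} (suc zero) = refl
mate-involutive {suc t} (suc (suc j)) = cong (λ i → suc (suc i)) (mate-involutive j)

mate-injective : ∀ {t} {i j : Fin (double t)} → mate i ≡ mate j → i ≡ j
mate-injective {i = i} {j} e =
  trans (sym (mate-involutive i)) (trans (cong mate e) (mate-involutive j))

mate-≢ : ∀ {t} (j : Fin (double t)) → mate j ≢ j
mate-≢ {suc t} zero ()
mate-≢ {suc t} (suc zero) ()
mate-≢ {suc t} (suc (suc j)) e = mate-≢ j (suc-injective (suc-injective e))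

two-or-three-plus-double : ∀ n → 1 < n → ∃ λ t → n ≡ 2 + double t ⊎ n ≡ 3 + double t
two-or-three-plus-double zero ()
two-or-three-plus-double (suc zero) (s≤s ())
two-or-three-plus-double (suc (suc zero)) _ = 0 , inj₁ refl
two-or-three-plus-double (suc (suc (suc zero))) _ = 0 , inj₂ refl
two-or-three-plus-double (suc (suc (suc (suc n)))) _ =
  let t , n≡ = two-or-three-plus-double (suc (suc n)) (s≤s (s≤s z≤n))
  in suc t , Sum.map (cong (2 +_)) (cong (2 +_)) n≡

module Ladder (k′ t : ℕ) where

  k m n : ℕ
  k = suc k′
  m = double t
  n = k + m

  open VertexPairs (onlyX₁Y₁? n n) public

  data Side : Set where
    X Y : Side

  far : Side → Fin m → Vertex
  far X j = inj₁ (k ↑ʳ j)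
  far Y j = inj₂ (k ↑ʳ j)

  far-injective : ∀ s {i j} → far s i ≡ far s j → i ≡ j
  far-injective X e = ↑ʳ-injective k _ _ (inj₁-injective e)
  far-injective Y e = ↑ʳ-injective k _ _ (inj₂-injective e)

  -- toℕ (k ↑ʳ i) is a successor, so no far pair is the cross edge x₁ y₁.
  far-nonadjacent : ∀ i j → ¬ far X i ~ far Y j
  far-nonadjacent i j (() , _)

  rung : Fin m → VPair
  rung j = vpair (far X j) (far Y j) (λ ())

  rail : Side → Fin m → VPair
  rail s j = vpair (far s j) (far s (mate j)) (mate-≢ j ∘ sym ∘ far-injective s)

  rungs : List VPair
  rungs = map rung (allFin m)

  rails : Side → List VPair
  rails s = map (rail s) (allFin m)

  ladder : List VPair
  ladder = rungs ++ rails X ++ rails Y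

  data LadderPair : VPair → Set where
    is-rung : ∀ j → LadderPair (rung j)
    is-rail : ∀ s j → LadderPair (rail s j)

  ∈-ladder⁺ : ∀ {Q} → LadderPair Q → Q ∈ ladder
  ∈-ladder⁺ (is-rung j) = ∈-++⁺ˡ (∈-map⁺ rung (∈-allFin j))
  ∈-ladder⁺ (is-rail X j) = ∈-++⁺ʳ rungs (∈-++⁺ˡ (∈-map⁺ (rail X) (∈-allFin j)))
  ∈-ladder⁺ (is-rail Y j) = ∈-++⁺ʳ rungs (∈-++⁺ʳ (rails X) (∈-map⁺ (rail Y) (∈-allFin j)))

  ∈-ladder⁻ : ∀ {Q} → Q ∈ ladder → LadderPair Q
  ∈-ladder⁻ {Q} =
    Sum.[ via is-rung , Sum.[ via (is-rail X) , via (is-rail Y) ]′ ∘ ∈-++⁻ (rails X) ]′ ∘ ∈-++⁻ rungs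
    where
    via : ∀ {f : Fin m → VPair} → (∀ j → LadderPair (f j)) → Q ∈ map f (allFin m) → LadderPair Q
    via {f} ladderPair Q∈ with ∈-map⁻ f Q∈
    ... | j , _ , refl = ladderPair j

  rung-rung : ∀ i j → Compatible (rung i) (rung j)
  rung-rung i j with i ≟ j
  ... | yes refl = hinge (here refl) (here refl) (refl , ~-irrefl (far Y i))
  ... | no i≢j = inj₁ (i≢j ∘ far-injective X , (λ ()) , (λ ()) , i≢j ∘ far-injective Y)

  rung-rail : ∀ i s j → Compatible (rung i) (rail s j)
  rung-rail i X j with i ≟ j | i ≟ mate j
  ... | yes refl | _ =
    hinge (here refl) (here refl) (refl , far-nonadjacent (mate i) i)
  ... | no _ | yes refl =
    hinge (here refl) (there (here refl)) (refl , far-nonadjacent j (mate j))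
  ... | no i≢j | no i≢j′ = inj₁ (i≢j ∘ far-injective X , i≢j′ ∘ far-injective X , (λ ()) , (λ ()))
  rung-rail i Y j with i ≟ j | i ≟ mate j
  ... | yes refl | _ = hinge (there (here refl)) (here refl) (refl , far-nonadjacent i (mate i))
  ... | no _ | yes refl = hinge (there (here refl)) (there (here refl)) (refl , far-nonadjacent (mate j) j)
  ... | no i≢j | no i≢j′ = inj₁ ((λ ()) , (λ ()) , i≢j ∘ far-injective Y , i≢j′ ∘ far-injective Y)

  same-rail : ∀ s i j → Compatible (rail s i) (rail s j)
  same-rail s i j with i ≟ j | j ≟ mate i
  ... | yes refl | _ = hinge (here refl) (here refl) (refl , ~-irrefl (far s (mate i)))
  ... | no _ | yes refl =
    hinge (here refl) (there (here refl))
          (cong (far s) (sym (mate-involutive i)) , ~-irrefl (far s (mate i)))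
  ... | no i≢j | no j≢i′ =
    inj₁ (i≢j ∘ far-injective s ,
          (λ e → j≢i′ (sym (trans (cong mate (far-injective s e)) (mate-involutive j)))) ,
          j≢i′ ∘ sym ∘ far-injective s ,
          i≢j ∘ mate-injective ∘ far-injective s)

  rail-rail : ∀ s s′ i j → Compatible (rail s i) (rail s′ j)
  rail-rail X X = same-rail X
  rail-rail Y Y = same-rail Y
  rail-rail X Y i j = inj₁ ((λ ()) , (λ ()) , (λ ()) , (λ ()))
  rail-rail Y X i j = inj₁ ((λ ()) , (λ ()) , (λ ()) , (λ ()))

  ladder-compatible : ∀ {P Q} → LadderPair P → LadderPair Q → Compatible P Q
  ladder-compatible (is-rung i) (is-rung j) = rung-rung i j
  ladder-compatible (is-rung i) (is-rail s j) = rung-rail i s j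
  ladder-compatible (is-rail s i) (is-rung j) = compatible-sym (rung-rail j s i)
  ladder-compatible (is-rail s i) (is-rail s′ j) = rail-rail s s′ i j

  ladder-covers : ∀ s j c → Any (λ Q → Covers Q c (far s j)) ladder
  ladder-covers X j (inj₁ i) =
    lose (∈-ladder⁺ (is-rail X j)) (here (inj₂ (refl , ≡⊎~ˣ i (k ↑ʳ mate j))))
  ladder-covers X j (inj₂ i) =
    lose (∈-ladder⁺ (is-rung j)) (here (inj₂ (refl , ≡⊎~ʸ i (k ↑ʳ j))))
  ladder-covers Y j (inj₁ i) =
    lose (∈-ladder⁺ (is-rung j)) (there (here (inj₂ (refl , ≡⊎~ˣ i (k ↑ʳ j)))))
  ladder-covers Y j (inj₂ i) =
    lose (∈-ladder⁺ (is-rail Y j)) (here (inj₂ (refl , ≡⊎~ʸ i (k ↑ʳ mate j))))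

  Local : Vertex → Set
  Local c = toℕ (reduce c) ℕ.< k

  Local? : ∀ c → Dec (Local c)
  Local? c = toℕ (reduce c) ℕ.<? k

  far-nonlocal : ∀ s j → ¬ Local (far s j)
  far-nonlocal X j lt = <⇒≱ lt (subst (k ℕ.≤_) (sym (toℕ-↑ʳ k j)) (m≤m+n k (toℕ j)))
  far-nonlocal Y j = far-nonlocal X j

  ladder-nonlocal : ∀ {Q} → LadderPair Q → ¬ Local (end₁ Q) × ¬ Local (end₂ Q)
  ladder-nonlocal (is-rung j) = far-nonlocal X j , far-nonlocal Y j
  ladder-nonlocal (is-rail s j) = far-nonlocal s j , far-nonlocal s (mate j)

  local-ladder-disjoint : ∀ {P Q} → Local (end₁ P) × Local (end₂ P) → LadderPair Q → Disjoint P Q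
  local-ladder-disjoint (ℓ₁ , ℓ₂) ladderPair =
    let ¬ℓ₁ , ¬ℓ₂ = ladder-nonlocal ladderPair
    in apart ℓ₁ ¬ℓ₁ , apart ℓ₁ ¬ℓ₂ , apart ℓ₂ ¬ℓ₁ , apart ℓ₂ ¬ℓ₂
    where
    apart : ∀ {c d} → Local c → ¬ Local d → c ≢ d
    apart ℓ ¬ℓ refl = ¬ℓ ℓ

  x y : Fin k → Vertex
  x i = inj₁ (i ↑ˡ m)
  y i = inj₂ (i ↑ˡ m)

  locals : List Vertex
  locals = map x (allFin k) ++ map y (allFin k)

  x∈locals : ∀ l → x l ∈ locals
  x∈locals l = ∈-++⁺ˡ (∈-map⁺ x (∈-allFin l))

  y∈locals : ∀ l → y l ∈ locals
  y∈locals l = ∈-++⁺ʳ (map x (allFin k)) (∈-map⁺ y (∈-allFin l))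

  local-or-far : ∀ c → c ∈ locals ⊎ ∃ λ s → ∃ λ j → c ≡ far s j
  local-or-far (inj₁ i) with splitAt k i in eq
  ... | inj₁ l = inj₁ (subst (_∈ locals) (cong inj₁ (splitAt⁻¹-↑ˡ eq)) (x∈locals l))
  ... | inj₂ j = inj₂ (X , j , cong inj₁ (sym (splitAt⁻¹-↑ʳ eq)))
  local-or-far (inj₂ i) with splitAt k i in eq
  ... | inj₁ l = inj₁ (subst (_∈ locals) (cong inj₂ (splitAt⁻¹-↑ˡ eq)) (y∈locals l))
  ... | inj₂ j = inj₂ (Y , j , cong inj₂ (sym (splitAt⁻¹-↑ʳ eq)))

  record Certificate (D : List VPair) : Set where
    field
      ends-local : All (λ P → Local (end₁ P) × Local (end₂ P)) D
      pairwise-compatible : All (λ P → All (Compatible P) D) D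
      pairwise-distinct : AllPairs (λ P Q → ¬ SameEnds P Q) D
      covers-locals : All (λ c → All (λ d → c ≡ d ⊎ Any (λ Q → Covers Q c d) D) locals) locals

  certificate? : ∀ D → Dec (Certificate D)
  certificate? D =
    map′ (λ (ℓ , c , d , v) → record { ends-local = ℓ ; pairwise-compatible = c
                                     ; pairwise-distinct = d ; covers-locals = v })
         (λ cert → let open Certificate cert
                   in ends-local , pairwise-compatible , pairwise-distinct , covers-locals)
         (all? (λ P → Local? (end₁ P) ×-dec Local? (end₂ P)) D ×-dec
          all? (λ P → all? (compatible? P) D) D ×-dec
          allPairs? (λ P Q → ¬? (sameEnds? P Q)) D ×-dec
          all? (λ c → all? (λ d → (c ≟ᵥ d) ⊎-dec any? (λ Q → covers? Q c d) D) locals) locals)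

  -- The rails of j and of mate j name the same 2-subsets, hence the deduplication.
  ladderTokens : List (TwoSubset (n + n))
  ladderTokens = deduplicate _≟ₜ_ (map ⟦_⟧ ladder)

  tokens : List VPair → List (TwoSubset (n + n))
  tokens D = map ⟦_⟧ D ++ ladderTokens

  length-tokens : ∀ D → length (tokens D) ≡ length D + length ladderTokens
  length-tokens D = trans (length-++ (map ⟦_⟧ D)) (cong (_+ _) (length-map ⟦_⟧ D))

  module _ {D : List VPair} (cert : Certificate D) where
    open Certificate cert

    all-compatible : ∀ {P Q} → P ∈ D ++ ladder → Q ∈ D ++ ladder → Compatible P Q
    all-compatible {P} {Q} P∈ Q∈ with ∈-++⁻ D P∈ | ∈-++⁻ D Q∈
    ... | inj₁ P∈D | inj₁ Q∈D = All.lookup (All.lookup pairwise-compatible P∈D) Q∈D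
    ... | inj₁ P∈D | inj₂ Q∈L =
      inj₁ (local-ladder-disjoint {P} {Q} (All.lookup ends-local P∈D) (∈-ladder⁻ Q∈L))
    ... | inj₂ P∈L | inj₁ Q∈D =
      compatible-sym {Q} {P}
        (inj₁ (local-ladder-disjoint {Q} {P} (All.lookup ends-local Q∈D) (∈-ladder⁻ P∈L)))
    ... | inj₂ P∈L | inj₂ Q∈L = ladder-compatible (∈-ladder⁻ P∈L) (∈-ladder⁻ Q∈L)

    all-covered : ∀ c d → c ≢ d → Any (λ Q → Covers Q c d) (D ++ ladder)
    all-covered c d c≢d with local-or-far c | local-or-far d
    ... | _ | inj₂ (s , j , refl) = Any.++⁺ʳ D (ladder-covers s j c)
    ... | inj₂ (s , j , refl) | _ = Any.++⁺ʳ D (Any.map (Any.map Sum.swap) (ladder-covers s j d))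
    ... | inj₁ c∈ | inj₁ d∈ =
      Any.++⁺ˡ (Sum.[ ⊥-elim ∘ c≢d , id ]′
                      (All.lookup (All.lookup covers-locals c∈) d∈))

    tokens-unique : Unique (tokens D)
    tokens-unique = Unique.++⁺ local-unique (deduplicate-! _≟ₜ_ (map ⟦_⟧ ladder)) local∩ladder
      where
      local-unique : Unique (map ⟦_⟧ D)
      local-unique = AllPairs.map⁺ (AllPairs.map (λ {P} {Q} ¬same → ¬same ∘ ⟦⟧-injective {P} {Q})
                                                 pairwise-distinct)
      local∩ladder : ∀ {A} → ¬ (A ∈ map ⟦_⟧ D × A ∈ ladderTokens)
      local∩ladder (A∈D , A∈L)
        with ∈-map⁻ ⟦_⟧ A∈D | ∈-map⁻ ⟦_⟧ (∈-deduplicate⁻ _≟ₜ_ (map ⟦_⟧ ladder) A∈L)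
      ... | P , P∈D , refl | Q , Q∈L , ⟦P⟧≡⟦Q⟧ =
        disjoint⇒¬sameEnds {P} {Q}
          (local-ladder-disjoint {P} {Q} (All.lookup ends-local P∈D) (∈-ladder⁻ Q∈L))
          (⟦⟧-injective {P} {Q} ⟦P⟧≡⟦Q⟧)

    tokens-maximal : MaximalIndependent (T₂ G) (tokens D)
    tokens-maximal =
      maximal-independent (D ++ ladder) (tokens D) tokens⊆ ⊆tokens tokens-unique
                          all-compatible all-covered
      where
      tokens⊆ : tokens D ⊆ map ⟦_⟧ (D ++ ladder)
      tokens⊆ A∈ rewrite map-++ ⟦_⟧ D ladder =
        Sum.[ ∈-++⁺ˡ , ∈-++⁺ʳ (map ⟦_⟧ D) ∘ ∈-deduplicate⁻ _≟ₜ_ (map ⟦_⟧ ladder) ]′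
              (∈-++⁻ (map ⟦_⟧ D) A∈)
      ⊆tokens : map ⟦_⟧ (D ++ ladder) ⊆ tokens D
      ⊆tokens A∈ rewrite map-++ ⟦_⟧ D ladder =
        Sum.[ ∈-++⁺ˡ , ∈-++⁺ʳ (map ⟦_⟧ D) ∘ ∈-deduplicate⁺ _≟ₜ_ ]′ (∈-++⁻ (map ⟦_⟧ D) A∈)

  not-well-covered : ∀ D₁ D₂ → Certificate D₁ → Certificate D₂ → length D₁ ≢ length D₂ →
                     ¬ WellCovered (T₂ G)
  not-well-covered D₁ D₂ cert₁ cert₂ |D₁|≢|D₂| wellCovered = |D₁|≢|D₂| (+-cancelʳ-≡ _ _ _ (begin
    length D₁ + r       ≡⟨ length-tokens D₁ ⟨
    length (tokens D₁)  ≡⟨ wellCovered _ _ (tokens-maximal cert₁) (tokens-maximal cert₂) ⟩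
    length (tokens D₂)  ≡⟨ length-tokens D₂ ⟩
    length D₂ + r       ∎))
    where
    r = length ladderTokens

-- x (# i) and y (# i) are the paper's x_{i+1} and y_{i+1}.
module Even (t : ℕ) where
  open Ladder 1 t

  T₂-not-well-covered : ¬ WellCovered (T₂ G)
  T₂-not-well-covered =
    not-well-covered D₁ D₂ (from-yes (certificate? D₁)) (from-yes (certificate? D₂)) (λ ())
    where
    D₁ D₂ : List VPair
    D₁ = x (# 0) ─ x (# 1) ∷ x (# 0) ─ y (# 0) ∷ x (# 1) ─ y (# 1) ∷ y (# 0) ─ y (# 1) ∷ []
    D₂ = x (# 0) ─ x (# 1) ∷ x (# 0) ─ y (# 1) ∷ []

module Odd (t : ℕ) where
  open Ladder 2 t

  T₂-not-well-covered : ¬ WellCovered (T₂ G)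
  T₂-not-well-covered =
    not-well-covered D₁ D₂ (from-yes (certificate? D₁)) (from-yes (certificate? D₂)) (λ ())
    where
    D₁ D₂ : List VPair
    D₁ = x (# 0) ─ x (# 1) ∷ x (# 0) ─ y (# 1) ∷ x (# 2) ─ y (# 2) ∷ y (# 1) ─ y (# 2) ∷ []
    D₂ = x (# 0) ─ x (# 1) ∷ x (# 0) ─ y (# 1) ∷ x (# 1) ─ y (# 2) ∷ x (# 2) ─ y (# 0) ∷
         y (# 1) ─ y (# 2) ∷ []

theorem7p1 : (n : ℕ) → 1 < n → ¬ WellCovered (T₂ (𝒢-graph n n (OnlyX₁Y₁ n n)))
theorem7p1 n 1<n with two-or-three-plus-double n 1<n
... | t , inj₁ refl = Even.T₂-not-well-covered t
... | t , inj₂ refl = Odd.T₂-not-well-covered t
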